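{- For every even integer $n \geq 4$, the honeycomb toroidal graph $\mathrm{HTG}(2,n,0)$ is 2-spanning cyclable.
   Context: For integers $m\ge 1$, $\ell\ge 0$ and $n\ge 4$ with $n$ even and $m-\ell$ even, the honeycomb toroidal graph $\mathrm{HTG}(m,n,\ell)$ is the simple graph with vertex set $\{u_{i,j}: 0\le i\le m-1,\ 0\le j\le n-1\}$ (first subscript computed modulo $m$, second modulo $n$) whose edge set is the set of the following unordered pairs: $\{u_{i,j},u_{i,j+1}\}$ for all $i,j$ (vertical edges); $\{u_{i,j},u_{i+1,j}\}$ for all $0\le i\le m-2$ with $i+j$ odd (flat edges); and $\{u_{m-1,j},u_{0,j+\ell}\}$ for all $j$ having the same parity as $m$ (and $\ell$) (jump edges). A 2-factor of a graph is a spanning subgraph in which every vertex has valency 2. A graph $X$ is 2-spanning cyclable if for every pair of distinct vertices $u,v$ of $X$ there is a 2-factor of $X$ consisting of exactly two cycles such that $u$ and $v$ lie in different cycles. -}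

module Defs where

open import Data.Nat using (ℕ; zero; suc; _+_; _*_; _∸_; _<_; _%_)
open import Data.Fin using (Fin; toℕ)
open import Data.Product using (Σ; ∃; _×_; _,_)
open import Data.Sum using (_⊎_)
open import Relation.Binary.PropositionalEquality using (_≡_; _≢_)
open import Relation.Nullary using (¬_)
open import Relation.Binary.Construct.Closure.ReflexiveTransitive using (Star)

-- b is (a + k) reduced modulo n  (b < n is automatic since b : Fin n)
AddMod : (n : ℕ) → ℕ → ℕ → Fin n → Set
AddMod n a k b = ∃ λ q → a + k ≡ q * n + toℕ b

Vertex : ℕ → ℕ → Set
Vertex m n = Fin m × Fin n

-- Generating (oriented) edges of HTG(m,n,ℓ); the graph's edges are the
-- unordered pairs obtained from these.
data HTGEdge (m n ℓ : ℕ) : Vertex m n → Vertex m n → Set where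
  vertical : ∀ (i : Fin m) (j j' : Fin n) →
             AddMod n (toℕ j) 1 j' →
             HTGEdge m n ℓ (i , j) (i , j')
  flat : ∀ (i i' : Fin m) (j : Fin n) →
         toℕ i' ≡ suc (toℕ i) →
         (toℕ i + toℕ j) % 2 ≡ 1 →
         HTGEdge m n ℓ (i , j) (i' , j)
  jump : ∀ (i₁ i₀ : Fin m) (j j' : Fin n) →
         suc (toℕ i₁) ≡ m → toℕ i₀ ≡ 0 →
         toℕ j % 2 ≡ m % 2 →
         AddMod n (toℕ j) ℓ j' →
         HTGEdge m n ℓ (i₁ , j) (i₀ , j')

Adj : (m n ℓ : ℕ) → Vertex m n → Vertex m n → Set
Adj m n ℓ u v = u ≢ v × (HTGEdge m n ℓ u v ⊎ HTGEdge m n ℓ v u)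

-- F (a symmetric relation = set of unordered pairs) is a 2-factor of the graph with adjacency A
record IsTwoFactor {V : Set} (A : V → V → Set) (F : V → V → Set) : Set where
  field
    sym      : ∀ {u v} → F u v → F v u
    subgraph : ∀ {u v} → F u v → A u v
    degree2  : ∀ u → Σ V λ a → Σ V λ b →
               a ≢ b × F u a × F u b × (∀ w → F u w → w ≡ a ⊎ w ≡ b)

-- A graph is 2-spanning cyclable: for all distinct u v there is a 2-factor with
-- exactly two components (cycles), u and v in different ones.
TwoSpanningCyclable : (V : Set) → (V → V → Set) → Set₁
TwoSpanningCyclable V A =
  ∀ (u v : V) → u ≢ v →
  Σ (V → V → Set) λ F →
    IsTwoFactor A F ×
    ¬ Star F u v ×
    (∀ w → Star F u w ⊎ Star F v w)

HTG-TwoSpanningCyclable : (m n ℓ : ℕ) → Set₁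
HTG-TwoSpanningCyclable m n ℓ = TwoSpanningCyclable (Vertex m n) (Adj m n ℓ)

{-# OPTIONS --safe #-}
module Submission where

-- HTG(2, n, 0) is the prism over the n-cycle: two rows of n columns, consecutive columns joined
-- along each row, and every column carrying a rung (a flat edge at odd columns, a jump edge at
-- even ones).  Vertices in different rows are separated by the two row cycles.  For vertices in
-- one row, swap them if v lies in the column right after u (as n ≥ 3 they cannot both follow each
-- other) and rotate the prism so that u lies in column 0 and v outside columns 0 and 1.  Dropping
-- the rail edges between columns 1, 2 and n − 1, 0 and adding the rungs at columns 0, 1, 2 and
-- n − 1 then leaves a 4-cycle on columns 0, 1 and a cycle through all other columns.

open import Defs
open import Data.Nat using (ℕ; zero; suc; _+_; _∸_; _≤_; _<_; _%_; z≤n; s≤s)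
open import Data.Nat.Properties
  using (_≟_; _≤?_; ≤-trans; <-trans; <-≤-trans; <⇒≤; <⇒≢; ≤∧≢⇒<; ≰⇒>; n≤1+n; n<1+n; m≤n+m;
         m∸n+n≡m; m≢1+n+m; +-comm; +-identityʳ; *-identityˡ; 1+n≢n; 0≢1+n; suc-injective)
open import Data.Nat.DivMod using (m%n<n)
open import Data.Fin using (Fin; zero; suc; toℕ; fromℕ; fromℕ<; inject₁; lower₁; opposite)
open import Data.Fin.Properties
  using (toℕ-injective; toℕ-fromℕ; toℕ-fromℕ<; toℕ-inject₁; toℕ-inject₁-≢; toℕ-lower₁;
         inject₁-lower₁; lower₁-inject₁′; toℕ≤pred[n]; opposite-involutive)
  renaming (_≟_ to _≟ᶠ_)
open import Data.Product using (Σ; _×_; _,_; proj₁; proj₂)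
open import Data.Sum using (_⊎_; inj₁; inj₂; [_,_])
import Data.Sum as Sum
open import Data.Empty using (⊥; ⊥-elim)
open import Function.Base using (_∘_; id)
open import Function.Bundles using (Inverse; _↔_; mk↔ₛ′)
open import Relation.Nullary using (¬_; Dec; yes; no)
open import Relation.Nullary.Decidable using (_⊎-dec_)
open import Relation.Binary.PropositionalEquality
  using (_≡_; _≢_; refl; sym; trans; cong; subst; subst₂)
open import Relation.Binary.Construct.Closure.ReflexiveTransitive
  using (Star; ε; _◅_; _◅◅_; gmap; fold; reverse)

SeparatingTwoFactor : {V : Set} → (V → V → Set) → V → V → Set₁
SeparatingTwoFactor {V} A u v =
  Σ (V → V → Set) λ F → IsTwoFactor A F × ¬ Star F u v × (∀ w → Star F u w ⊎ Star F v w)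

module _ {V : Set} where

  SeparatingTwoFactor-sym : ∀ {A : V → V → Set} {u v} →
                            SeparatingTwoFactor A u v → SeparatingTwoFactor A v u
  SeparatingTwoFactor-sym (F , F-2f , u↛v , cover) =
    F , F-2f , (u↛v ∘ reverse (IsTwoFactor.sym F-2f)) , Sum.swap ∘ cover

  SeparatingTwoFactor-mono : ∀ {A B : V → V → Set} {u v} → (∀ {x y} → A x y → B x y) →
                             SeparatingTwoFactor A u v → SeparatingTwoFactor B u v
  SeparatingTwoFactor-mono {B = B} A⊆B (F , F-2f , separated) = F , F-2f′ , separated
    where
    F-2f′ : IsTwoFactor B F
    F-2f′ = record { sym = F.sym ; subgraph = λ f → A⊆B (F.subgraph f) ; degree2 = F.degree2 }
      where module F = IsTwoFactor F-2f

  SeparatingTwoFactor-transport : ∀ {A : V → V → Set} (σ : V ↔ V) →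
    (∀ {x y} → A x y → A (Inverse.to σ x) (Inverse.to σ y)) → ∀ {u v} →
    SeparatingTwoFactor A u v → SeparatingTwoFactor A (Inverse.to σ u) (Inverse.to σ v)
  SeparatingTwoFactor-transport {A} σ σ-hom {u} {v} (F , F-2f , u↛v , cover) =
    F′ , F′-2f , u↛v ∘ subst₂ (Star F) (from∘to u) (from∘to v) ∘ pull , cover′
    where
    open Inverse σ using (to; from)
      renaming (strictlyInverseˡ to to∘from; strictlyInverseʳ to from∘to)
    module F = IsTwoFactor F-2f

    F′ : V → V → Set
    F′ x y = F (from x) (from y)

    pull : ∀ {x y} → Star F′ x y → Star F (from x) (from y)
    pull = gmap from id

    push : ∀ {x y} → Star F x y → Star F′ (to x) (to y)
    push = gmap to (subst₂ F (sym (from∘to _)) (sym (from∘to _)))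

    neighbours : ∀ x → Σ V λ a → Σ V λ b →
                 a ≢ b × F′ x a × F′ x b × (∀ w → F′ x w → w ≡ a ⊎ w ≡ b)
    neighbours x with F.degree2 (from x)
    ... | a , b , a≢b , xa , xb , only =
      to a , to b , (λ e → a≢b (trans (sym (from∘to a)) (trans (cong from e) (from∘to b)))) ,
      subst (F (from x)) (sym (from∘to a)) xa , subst (F (from x)) (sym (from∘to b)) xb ,
      λ w xw → Sum.map (λ e → trans (sym (to∘from w)) (cong to e))
                       (λ e → trans (sym (to∘from w)) (cong to e)) (only (from w) xw)

    F′-2f : IsTwoFactor A F′
    F′-2f = record
      { sym      = F.sym
      ; subgraph = λ {x} {y} f → subst₂ A (to∘from x) (to∘from y) (σ-hom (F.subgraph f))
      ; degree2  = neighbours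
      }

    cover′ : ∀ w → Star F′ (to u) w ⊎ Star F′ (to v) w
    cover′ w = Sum.map (subst (Star F′ (to u)) (to∘from w) ∘ push)
                       (subst (Star F′ (to v)) (to∘from w) ∘ push) (cover (from w))

  SeparatingTwoFactor-byClosedSet : ∀ {A F : V → V → Set} (P : V → Set) {hub hub′ : V} →
    IsTwoFactor A F → (∀ x → Dec (P x)) → (∀ {x y} → F x y → P x → P y) →
    (∀ {x} → P x → Star F x hub) → (∀ {x} → ¬ P x → Star F x hub′) →
    ∀ {u v} → P u → ¬ P v → SeparatingTwoFactor A u v
  SeparatingTwoFactor-byClosedSet {F = F} P F-2f P? closed toHub toHub′ {u} {v} Pu ¬Pv =
    F , F-2f , (λ u⇝v → ¬Pv (preserved u⇝v Pu)) , cover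
    where
    preserved : ∀ {x y} → Star F x y → P x → P y
    preserved = fold (λ x y → P x → P y) (λ f rest → rest ∘ closed f) id

    cover : ∀ w → Star F u w ⊎ Star F v w
    cover w with P? w
    ... | yes Pw = inj₁ (toHub Pu ◅◅ reverse (IsTwoFactor.sym F-2f) (toHub Pw))
    ... | no ¬Pw = inj₂ (toHub′ ¬Pv ◅◅ reverse (IsTwoFactor.sym F-2f) (toHub′ ¬Pw))

Adj-sym : ∀ {m n ℓ u v} → Adj m n ℓ u v → Adj m n ℓ v u
Adj-sym (u≢v , e) = u≢v ∘ sym , Sum.swap e

m%2≡0⊎m%2≡1 : ∀ m → m % 2 ≡ 0 ⊎ m % 2 ≡ 1
m%2≡0⊎m%2≡1 m with m % 2 | m%n<n m 2
... | 0           | _               = inj₁ refl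
... | 1           | _               = inj₂ refl
... | suc (suc _) | s≤s (s≤s ())

≢-opposite : ∀ (i : Fin 2) → i ≢ opposite i
≢-opposite zero       ()
≢-opposite (suc zero) ()

module Prism (r : ℕ) where

  p : ℕ
  p = 3 + r

  Column : Set
  Column = Fin (suc p)

  V : Set
  V = Vertex 2 (suc p)

  csuc : Column → Column
  csuc j with p ≟ toℕ j
  ... | yes _   = zero
  ... | no p≢j  = suc (lower₁ j p≢j)

  cpred : Column → Column
  cpred zero    = fromℕ p
  cpred (suc j) = inject₁ j

  csuc-last : ∀ {j} → p ≡ toℕ j → csuc j ≡ zero
  csuc-last {j} p≡j with p ≟ toℕ j
  ... | yes _   = refl
  ... | no p≢j  = ⊥-elim (p≢j p≡j)

  toℕ-csuc : ∀ {j} → p ≢ toℕ j → toℕ (csuc j) ≡ suc (toℕ j)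
  toℕ-csuc {j} p≢j with p ≟ toℕ j
  ... | yes p≡j  = ⊥-elim (p≢j p≡j)
  ... | no p≢j′  = cong suc (toℕ-lower₁ j p≢j′)

  toℕ-cpred : ∀ {j t} → toℕ j ≡ suc t → toℕ (cpred j) ≡ t
  toℕ-cpred {suc j} j≡1+t = trans (toℕ-inject₁ j) (suc-injective j≡1+t)

  cpred-csuc : ∀ j → cpred (csuc j) ≡ j
  cpred-csuc j with p ≟ toℕ j
  ... | yes p≡j  = toℕ-injective (trans (toℕ-fromℕ p) p≡j)
  ... | no p≢j   = inject₁-lower₁ j p≢j

  csuc-cpred : ∀ j → csuc (cpred j) ≡ j
  csuc-cpred zero = csuc-last (sym (toℕ-fromℕ p))
  csuc-cpred (suc j) with p ≟ toℕ (inject₁ j)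
  ... | yes p≡j  = ⊥-elim (toℕ-inject₁-≢ j p≡j)
  ... | no p≢j   = cong suc (lower₁-inject₁′ j p≢j)

  ≢-cpred² : ∀ j → j ≢ cpred (cpred j)
  ≢-cpred² zero          ()
  ≢-cpred² (suc zero)    ()
  ≢-cpred² (suc (suc j)) j≡j-2 = m≢1+n+m (toℕ j) (sym 2+j≡j)
    where
    2+j≡j : suc (suc (toℕ j)) ≡ toℕ j
    2+j≡j = trans (cong toℕ j≡j-2) (trans (toℕ-inject₁ (inject₁ j)) (toℕ-inject₁ j))

  csuc≢cpred : ∀ j → csuc j ≢ cpred j
  csuc≢cpred j e = ≢-cpred² j (trans (sym (cpred-csuc j)) (cong cpred e))

  ≢-csuc : ∀ j → j ≢ csuc j
  ≢-csuc j e = csuc≢cpred j (trans (sym e) (trans (sym (cpred-csuc j)) (cong cpred (sym e))))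

  csuc-AddMod : ∀ j → AddMod (suc p) (toℕ j) 1 (csuc j)
  csuc-AddMod j with p ≟ toℕ j
  ... | yes p≡j = 1 , trans (+-comm (toℕ j) 1)
                      (trans (cong suc (sym p≡j)) (sym (trans (+-identityʳ _) (*-identityˡ _))))
  ... | no p≢j  = 0 , trans (+-comm (toℕ j) 1) (cong suc (sym (toℕ-lower₁ j p≢j)))

  rung-HTGEdge : ∀ j → HTGEdge 2 (suc p) 0 (zero , j) (suc zero , j)
                     ⊎ HTGEdge 2 (suc p) 0 (suc zero , j) (zero , j)
  rung-HTGEdge j with m%2≡0⊎m%2≡1 (toℕ j)
  ... | inj₁ even = inj₂ (jump (suc zero) zero j j refl refl even (0 , +-identityʳ (toℕ j)))
  ... | inj₂ odd  = inj₁ (flat zero (suc zero) j refl odd)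

  data Edge : V → V → Set where
    next : ∀ i j → Edge (i , j) (i , csuc j)
    prev : ∀ i j → Edge (i , j) (i , cpred j)
    rung : ∀ i j → Edge (i , j) (opposite i , j)

  Edge⇒Adj : ∀ {x y} → Edge x y → Adj 2 (suc p) 0 x y
  Edge⇒Adj (next i j)          = ≢-csuc j ∘ cong proj₂
                               , inj₁ (vertical i j (csuc j) (csuc-AddMod j))
  Edge⇒Adj (prev i j)          = subst (λ c → Adj 2 (suc p) 0 (i , c) (i , cpred j)) (csuc-cpred j)
                                       (Adj-sym (Edge⇒Adj (next i (cpred j))))
  Edge⇒Adj (rung zero j)       = (λ ()) , rung-HTGEdge j
  Edge⇒Adj (rung (suc zero) j) = (λ ()) , Sum.swap (rung-HTGEdge j)

  shift : V ↔ V
  shift = mk↔ₛ′ (λ (i , j) → i , csuc j) (λ (i , j) → i , cpred j)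
                (λ (i , j) → cong (i ,_) (csuc-cpred j)) (λ (i , j) → cong (i ,_) (cpred-csuc j))

  Edge-shift : ∀ {x y} → Edge x y → Edge (Inverse.to shift x) (Inverse.to shift y)
  Edge-shift (next i j) = next i (csuc j)
  Edge-shift (prev i j) = subst (λ c → Edge (i , csuc j) (i , c))
                                (trans (cpred-csuc j) (sym (csuc-cpred j))) (prev i (csuc j))
  Edge-shift (rung i j) = rung i (csuc j)

  -- Cut j removes the two rail edges between columns j and csuc j; the rungs kept are exactly
  -- those at columns next to a cut.
  module Ladders (Cut : Column → Set) (cut? : ∀ j → Dec (Cut j))
                 (isolated : ∀ j → Cut j → ¬ Cut (csuc j)) where

    data Link : V → V → Set where
      next : ∀ i j → ¬ Cut j → Link (i , j) (i , csuc j)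
      prev : ∀ i j → ¬ Cut (cpred j) → Link (i , j) (i , cpred j)
      rung : ∀ i j → Cut j ⊎ Cut (cpred j) → Link (i , j) (opposite i , j)

    Link-sym : ∀ {x y} → Link x y → Link y x
    Link-sym (next i j ¬c) = subst (λ c → Link (i , csuc j) (i , c)) (cpred-csuc j)
                                   (prev i (csuc j) (¬c ∘ subst Cut (cpred-csuc j)))
    Link-sym (prev i j ¬c) = subst (λ c → Link (i , cpred j) (i , c)) (csuc-cpred j)
                                   (next i (cpred j) ¬c)
    Link-sym (rung i j c)  = subst (λ i′ → Link (opposite i , j) (i′ , j)) (opposite-involutive i)
                                   (rung (opposite i) j c)

    Link⇒Edge : ∀ {x y} → Link x y → Edge x y
    Link⇒Edge (next i j _) = next i j
    Link⇒Edge (prev i j _) = prev i j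
    Link⇒Edge (rung i j _) = rung i j

    neighbours : ∀ x → Σ V λ a → Σ V λ b →
                 a ≢ b × Link x a × Link x b × (∀ w → Link x w → w ≡ a ⊎ w ≡ b)
    neighbours (i , j) with cut? j | cut? (cpred j)
    ... | no ¬c | no ¬c⁻ = _ , _ , csuc≢cpred j ∘ cong proj₂ , next i j ¬c , prev i j ¬c⁻ , λ where
      _ (next _ _ _) → inj₁ refl
      _ (prev _ _ _) → inj₂ refl
      _ (rung _ _ c) → ⊥-elim ([ ¬c , ¬c⁻ ] c)
    ... | yes c | no ¬c⁻ = _ , _ , ≢-opposite i ∘ cong proj₁ , prev i j ¬c⁻ , rung i j (inj₁ c) , λ where
      _ (next _ _ ¬c) → ⊥-elim (¬c c)
      _ (prev _ _ _)  → inj₁ refl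
      _ (rung _ _ _)  → inj₂ refl
    ... | no ¬c | yes c⁻ = _ , _ , ≢-opposite i ∘ cong proj₁ , next i j ¬c , rung i j (inj₂ c⁻) , λ where
      _ (next _ _ _)   → inj₁ refl
      _ (prev _ _ ¬c⁻) → ⊥-elim (¬c⁻ c⁻)
      _ (rung _ _ _)   → inj₂ refl
    ... | yes c | yes c⁻ = ⊥-elim (isolated (cpred j) c⁻ (subst Cut (sym (csuc-cpred j)) c))

    isTwoFactor : IsTwoFactor Edge Link
    isTwoFactor = record { sym = Link-sym ; subgraph = Link⇒Edge ; degree2 = neighbours }

    alongRail : ∀ i {s j} → toℕ s ≤ toℕ j → (∀ x → toℕ s ≤ toℕ x → toℕ x < toℕ j → ¬ Cut x) →
                Star Link (i , j) (i , s)
    alongRail i {s} {j} s≤j = go (toℕ j ∸ toℕ s) (sym (m∸n+n≡m s≤j))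
      where
      go : ∀ d {j} → toℕ j ≡ d + toℕ s → (∀ x → toℕ s ≤ toℕ x → toℕ x < toℕ j → ¬ Cut x) →
           Star Link (i , j) (i , s)
      go zero    j≡s _ with toℕ-injective j≡s
      ... | refl = ε
      go (suc d) {j} j≡1+d+s uncut =
        prev i j (uncut (cpred j) s≤j⁻ j⁻<j) ◅
          go d j⁻≡d+s (λ x s≤x x<j⁻ → uncut x s≤x (<-trans x<j⁻ j⁻<j))
        where
        j⁻≡d+s : toℕ (cpred j) ≡ d + toℕ s
        j⁻≡d+s = toℕ-cpred j≡1+d+s
        s≤j⁻ : toℕ s ≤ toℕ (cpred j)
        s≤j⁻ = subst (toℕ s ≤_) (sym j⁻≡d+s) (m≤n+m (toℕ s) d)
        j⁻<j : toℕ (cpred j) < toℕ j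
        j⁻<j = subst₂ _<_ (sym j⁻≡d+s) (sym j≡1+d+s) (n<1+n _)

    toRow0 : ∀ i j → Cut j ⊎ Cut (cpred j) → Star Link (i , j) (zero , j)
    toRow0 zero       j _ = ε
    toRow0 (suc zero) j c = rung (suc zero) j c ◅ ε

  rows-separating : ∀ a b → SeparatingTwoFactor Edge (zero , a) (suc zero , b)
  rows-separating a b =
    SeparatingTwoFactor-byClosedSet Top isTwoFactor (λ x → proj₁ x ≟ᶠ zero) Top-closed
      toTopHub toBottomHub refl λ ()
    where
    open Ladders (λ _ → ⊥) (λ _ → no λ ()) (λ _ ())

    Top : V → Set
    Top x = proj₁ x ≡ zero

    Top-closed : ∀ {x y} → Link x y → Top x → Top y
    Top-closed (next _ _ _)        = id
    Top-closed (prev _ _ _)        = id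
    Top-closed (rung _ _ (inj₁ ()))
    Top-closed (rung _ _ (inj₂ ()))

    toColumn0 : ∀ i j → Star Link (i , j) (i , zero)
    toColumn0 i j = alongRail i z≤n λ _ _ _ ()

    toTopHub : ∀ {x} → Top x → Star Link x (zero , zero)
    toTopHub {_ , j} refl = toColumn0 zero j

    toBottomHub : ∀ {x} → ¬ Top x → Star Link x (suc zero , zero)
    toBottomHub {zero , _}     ¬top = ⊥-elim (¬top refl)
    toBottomHub {suc zero , j} _    = toColumn0 (suc zero) j

  module Split (k : ℕ) (1≤k : 1 ≤ k) (k+2≤p : 2 + k ≤ p) where

    Cut : Column → Set
    Cut j = toℕ j ≡ k ⊎ toℕ j ≡ p

    k<p : k < p
    k<p = <⇒≤ k+2≤p

    isolated : ∀ j → Cut j → ¬ Cut (csuc j)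
    isolated j (inj₁ j≡k) = [ (λ e → 1+n≢n (trans (sym j+1≡k+1) e))
                            , (λ e → <⇒≢ k+2≤p (trans (sym j+1≡k+1) e)) ]
      where
      j+1≡k+1 : toℕ (csuc j) ≡ suc k
      j+1≡k+1 = trans (toℕ-csuc (λ p≡j → <⇒≢ k<p (sym (trans p≡j j≡k)))) (cong suc j≡k)
    isolated j (inj₂ j≡p) = [ (λ e → <⇒≢ 1≤k (trans (sym j+1≡0) e))
                            , (λ e → 0≢1+n (trans (sym j+1≡0) e)) ]
      where
      j+1≡0 : toℕ (csuc j) ≡ 0
      j+1≡0 = cong toℕ (csuc-last (sym j≡p))

    open Ladders Cut (λ j → (toℕ j ≟ k) ⊎-dec (toℕ j ≟ p)) isolated

    Left : V → Set
    Left x = toℕ (proj₂ x) ≤ k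

    Left-closed : ∀ {x y} → Link x y → Left x → Left y
    Left-closed (next _ j ¬c)       j≤k = subst (_≤ k) (sym (toℕ-csuc (¬c ∘ inj₂ ∘ sym)))
                                                (≤∧≢⇒< j≤k (¬c ∘ inj₁))
    Left-closed (prev _ zero ¬c)    _   = ⊥-elim (¬c (inj₂ (toℕ-fromℕ p)))
    Left-closed (prev _ (suc j) _)  j≤k = subst (_≤ k) (sym (toℕ-inject₁ j)) (≤-trans (n≤1+n _) j≤k)
    Left-closed (rung _ _ _)        j≤k = j≤k

    toLeftHub : ∀ {x} → Left x → Star Link x (zero , zero)
    toLeftHub {i , j} j≤k = alongRail i z≤n uncut ◅◅ toRow0 i zero (inj₂ (inj₂ (toℕ-fromℕ p)))
      where
      uncut : ∀ x → 0 ≤ toℕ x → toℕ x < toℕ j → ¬ Cut x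
      uncut x _ x<j = [ <⇒≢ (<-≤-trans x<j j≤k) , <⇒≢ (<-≤-trans x<j (≤-trans j≤k (<⇒≤ k<p))) ]

    firstRight : Column
    firstRight = suc (fromℕ< k<p)

    toRightHub : ∀ {x} → ¬ Left x → Star Link x (zero , firstRight)
    toRightHub {i , j} j≰k = alongRail i r≤j uncut ◅◅ toRow0 i firstRight (inj₂ (inj₁ cpred≡k))
      where
      toℕ-firstRight : toℕ firstRight ≡ suc k
      toℕ-firstRight = cong suc (toℕ-fromℕ< k<p)
      cpred≡k : toℕ (cpred firstRight) ≡ k
      cpred≡k = toℕ-cpred toℕ-firstRight
      r≤j : toℕ firstRight ≤ toℕ j
      r≤j = subst (_≤ toℕ j) (sym toℕ-firstRight) (≰⇒> j≰k)
      uncut : ∀ x → toℕ firstRight ≤ toℕ x → toℕ x < toℕ j → ¬ Cut x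
      uncut x r≤x x<j = [ (λ x≡k → <⇒≢ (subst (_≤ toℕ x) toℕ-firstRight r≤x) (sym x≡k))
                        , <⇒≢ (<-≤-trans x<j (toℕ≤pred[n] j)) ]

    separating : ∀ {u v} → Left u → ¬ Left v → SeparatingTwoFactor Edge u v
    separating = SeparatingTwoFactor-byClosedSet Left isTwoFactor (λ x → toℕ (proj₂ x) ≤? k)
                   Left-closed toLeftHub toRightHub

  column0-separating : ∀ i {b} → zero ≢ b → csuc zero ≢ b →
                       SeparatingTwoFactor Edge (i , zero) (i , b)
  column0-separating i {zero}        0≢b _   = ⊥-elim (0≢b refl)
  column0-separating i {suc zero}    _   1≢b = ⊥-elim (1≢b refl)
  column0-separating i {suc (suc _)} _   _   =
    Split.separating 1 (s≤s z≤n) (s≤s (s≤s (s≤s z≤n))) z≤n λ { (s≤s ()) }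

  sameRow-separating-≢csuc : ∀ i {a b} → a ≢ b → csuc a ≢ b →
                             SeparatingTwoFactor Edge (i , a) (i , b)
  sameRow-separating-≢csuc i {a} = go (toℕ a) refl
    where
    go : ∀ t {a b} → toℕ a ≡ t → a ≢ b → csuc a ≢ b → SeparatingTwoFactor Edge (i , a) (i , b)
    go zero a≡0 a≢b a+1≢b with toℕ-injective {j = zero} a≡0
    ... | refl = column0-separating i a≢b a+1≢b
    go (suc t) {a} {b} a≡1+t a≢b a+1≢b =
      subst₂ (SeparatingTwoFactor Edge) (cong (i ,_) (csuc-cpred a)) (cong (i ,_) (csuc-cpred b))
        (SeparatingTwoFactor-transport shift Edge-shift (go t (toℕ-cpred a≡1+t) a⁻≢b⁻ a⁻+1≢b⁻))
      where
      a⁻≢b⁻ : cpred a ≢ cpred b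
      a⁻≢b⁻ e = a≢b (trans (sym (csuc-cpred a)) (trans (cong csuc e) (csuc-cpred b)))
      a⁻+1≢b⁻ : csuc (cpred a) ≢ cpred b
      a⁻+1≢b⁻ e = a+1≢b (trans (cong csuc (trans (sym (csuc-cpred a)) e)) (csuc-cpred b))

  sameRow-separating : ∀ i {a b} → a ≢ b → SeparatingTwoFactor Edge (i , a) (i , b)
  sameRow-separating i {a} {b} a≢b with csuc a ≟ᶠ b
  ... | no a+1≢b  = sameRow-separating-≢csuc i a≢b a+1≢b
  ... | yes a+1≡b = SeparatingTwoFactor-sym (sameRow-separating-≢csuc i (a≢b ∘ sym) b+1≢a)
    where
    b+1≢a : csuc b ≢ a
    b+1≢a b+1≡a = csuc≢cpred a (trans a+1≡b (trans (sym (cpred-csuc b)) (cong cpred b+1≡a)))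

  twoSpanningCyclable : TwoSpanningCyclable V Edge
  twoSpanningCyclable (zero , a)     (zero , b)     u≢v =
    sameRow-separating zero (u≢v ∘ cong (zero ,_))
  twoSpanningCyclable (zero , a)     (suc zero , b) _   =
    rows-separating a b
  twoSpanningCyclable (suc zero , a) (zero , b)     _   =
    SeparatingTwoFactor-sym (rows-separating b a)
  twoSpanningCyclable (suc zero , a) (suc zero , b) u≢v =
    sameRow-separating (suc zero) (u≢v ∘ cong (suc zero ,_))

lemma3p1 : (n : ℕ) → 4 ≤ n → n % 2 ≡ 0 → HTG-TwoSpanningCyclable 2 n 0
lemma3p1 (suc (suc (suc (suc r)))) (s≤s (s≤s (s≤s (s≤s _)))) _ u v u≢v =
  SeparatingTwoFactor-mono (Prism.Edge⇒Adj r) (Prism.twoSpanningCyclable r u v u≢v)
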